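{- Let $T$ be a finite tree and $M$ a perfect matching of $T$. Then for every edge $xy\in M$, the graph $T^3_B$ has a Hamiltonian $(x,y)$-path (a path from $x$ to $y$ containing all vertices of $T$) which crosses every edge $e\in E(T)\setminus M$ exactly twice with respect to $T$.
   Context: $T^3_B$ is the graph on $V(T)$ in which two vertices are adjacent iff their distance in $T$ is $1$ or $3$ (more generally $G^t_B$ joins vertices at odd distance at most $t$). For disjoint $A,B\subseteq V(G)$, a nontrivial path $P=v_0v_1\dots v_p$ is an $(A,B)$-path if $V(P)\cap A=\{v_0\}$ and $V(P)\cap B=\{v_p\}$; for subgraphs $H,K$, an $(H,K)$-path means a $(V(H),V(K))$-path. If $F$ is a path or cycle, $T$ a tree, $e\in E(T)$, and $T_1,T_2$ the two components of $T-e$, then $F$ crosses $e$ exactly $k$ times with respect to $T$ if $F$ contains exactly $k$ $(T_1,T_2)$-paths (as subpaths). -}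

module Defs where

open import Level using (0ℓ)
open import Data.Nat using (ℕ; zero; suc; _+_; _*_; _∸_; _≤_; _<_)
open import Data.Fin using (Fin)
open import Data.Product using (Σ; ∃; _×_; _,_)
open import Data.Sum using (_⊎_)
open import Data.Maybe using (Maybe; just)
open import Data.List using (List; []; _∷_; _++_; [_]; length; head; last; take; drop)
open import Data.List.Membership.Propositional using (_∈_)
open import Data.List.Relation.Unary.Linked using (Linked)
open import Data.List.Relation.Unary.Unique.Propositional using (Unique)
open import Relation.Binary.PropositionalEquality using (_≡_)
open import Relation.Nullary using (¬_)
open import Function.Bundles using (_⇔_)

Rel : ℕ → Set₁
Rel n = Fin n → Fin n → Set

record Graph (n : ℕ) : Set₁ where
  field
    Adj   : Rel n
    sym   : ∀ {u v} → Adj u v → Adj v u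
    irefl : ∀ {u} → ¬ Adj u u
open Graph public

IsPath : ∀ {n} → Rel n → List (Fin n) → Set
IsPath R P = Linked R P × Unique P

PathBetween : ∀ {n} → Rel n → Fin n → Fin n → List (Fin n) → Set
PathBetween R u v P = IsPath R P × head P ≡ just u × last P ≡ just v

IsCycle : ∀ {n} → Rel n → List (Fin n) → Set
IsCycle {n} R C = IsPath R C × 3 ≤ length C
  × Σ (Fin n) λ a → Σ (Fin n) λ b → head C ≡ just a × last C ≡ just b × R b a

Connected : ∀ {n} → Graph n → Set
Connected G = ∀ u v → ∃ λ P → PathBetween (Adj G) u v P

Acyclic : ∀ {n} → Graph n → Set
Acyclic G = ∀ C → ¬ IsCycle (Adj G) C

IsTree : ∀ {n} → Graph n → Set
IsTree G = Connected G × Acyclic G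

-- dist_G(u,v) ≡ k : a path of length k (k edges) exists and no path is shorter.
Dist : ∀ {n} → Graph n → Fin n → Fin n → ℕ → Set
Dist G u v k = (∃ λ P → PathBetween (Adj G) u v P × length P ≡ suc k)
             × (∀ P → PathBetween (Adj G) u v P → suc k ≤ length P)

BipPower : ∀ {n} → Graph n → ℕ → Rel n
BipPower G t u v = ∃ λ k → Dist G u v k × (∃ λ m → k ≡ suc (2 * m)) × k ≤ t

record PerfectMatching {n} (G : Graph n) : Set₁ where
  field
    M      : Rel n
    inE    : ∀ {u v} → M u v → Adj G u v
    msym   : ∀ {u v} → M u v → M v u
    cover  : ∀ v → ∃ λ u → M v u
    unique : ∀ {v u u'} → M v u → M v u' → u ≡ u'
open PerfectMatching public

AdjMinus : ∀ {n} → Graph n → Fin n → Fin n → Rel n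
AdjMinus G u v a b = Adj G a b × ¬ ((a ≡ u × b ≡ v) ⊎ (a ≡ v × b ≡ u))

Side : ∀ {n} → Graph n → Fin n → Fin n → Fin n → Set
Side G u v w = ∃ λ P → PathBetween (AdjMinus G u v) u w P

IsABPath : ∀ {n} → (Fin n → Set) → (Fin n → Set) → List (Fin n) → Set
IsABPath {n} A B S = Σ (Fin n) λ a → Σ (Fin n) λ b → Σ (List (Fin n)) λ mid →
    S ≡ a ∷ (mid ++ [ b ]) × A a × B b
  × (∀ w → w ∈ S → A w → w ≡ a) × (∀ w → w ∈ S → B w → w ≡ b)

-- Subpath of F between positions i ≤ j (inclusive).
Segment : ∀ {n} → List (Fin n) → ℕ → ℕ → List (Fin n)
Segment F i j = take (suc j ∸ i) (drop i F)

-- F contains exactly k (A,B)-paths as subpaths (a subpath, being undirected,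
-- is an (A,B)-path if it is one in either orientation); subpaths are
-- identified by their position (i , j), i < j < length F.
ContainsExactly : ∀ {n} → (Fin n → Set) → (Fin n → Set) → List (Fin n) → ℕ → Set
ContainsExactly A B F k = ∃ λ (L : List (ℕ × ℕ)) → Unique L × length L ≡ k
  × (∀ i j → ((i , j) ∈ L) ⇔ (i < j × j < length F
       × (IsABPath A B (Segment F i j) ⊎ IsABPath B A (Segment F i j))))

CrossesExactly : ∀ {n} → Graph n → Fin n → Fin n → List (Fin n) → ℕ → Set
CrossesExactly T u v F k = ContainsExactly (Side T u v) (Side T v u) F k

-- Root T at x. Since M is perfect, a vertex a that is matched to a child b has every other
-- child c, and every child d of b, matched to a child of its own. This allows a recursive
-- construction of a path H(a) from a to b through the whole subtree of a: start at a, run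
-- H(d) backwards (from the mate of d to d) for each child d of b, then H(c) for each other
-- child c of a, and finish at b. Every junction joins vertices at distance 1 or 3 in T
-- (a-b-d-d', d-b-e-e', d-b-a-c, c'-c-a-e, c'-c-a-b, where primes denote mates), so H(a) is a
-- path in the bipartite cube.
--
-- In a path, the (A,B)-subpaths for a partition {A,B} of the vertices are exactly the steps
-- from one part to the other; for the sides of T - pc (c the child of p, pc not in M) they are
-- the steps into and out of the subtree of c. Let H(e) be the block of H(a) containing c.
-- If e = c, the subtree of c is this block: one step in, one step out. Otherwise both ends e
-- and e' of the block lie outside the subtree of c (c = e' would put pc in M), so all crossing
-- steps lie inside H(e), and there are two of them by induction.

module Submission where

open import Defs hiding (sym)
open import Data.Nat using (ℕ; zero; suc; _+_; _≤_; _<_; z≤n; s≤s)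
open import Data.Nat.Properties
open import Data.Fin using (Fin) renaming (_≟_ to _≟ᶠ_)
open import Data.Product using (∃; ∃₂; _×_; _,_; proj₁; proj₂)
import Data.Product
open import Data.Sum using (_⊎_; inj₁; inj₂)
import Data.Sum
open import Data.Maybe using (just)
open import Data.Maybe.Properties using (just-injective)
import Data.Maybe.Relation.Binary.Connected as Maybe
open import Data.List
  using (List; []; _∷_; _++_; [_]; _∷ʳ_; length; head; last; reverse; drop; concatMap; filter; allFin; map)
open import Data.List.Properties
  using (++-assoc; ++-identityʳ; ++-cancelˡ; ∷ʳ-injective; unfold-reverse; reverse-++;
         length-++; length-reverse; length-map; ≡-dec)
open import Data.List.Membership.Propositional using (_∈_; _∉_; find; lose)
open import Data.List.Membership.Propositional.Properties
  using (∈-∃++; ∈-++⁻; ∈-++⁺ˡ; ∈-++⁺ʳ; ∈-map⁺; ∈-map⁻; ∈-concatMap⁺; ∈-concatMap⁻; ∈-filter⁺; ∈-filter⁻; ∈-allFin)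
open import Data.List.Relation.Unary.Any using (Any; here; there)
import Data.List.Relation.Unary.Any.Properties as Any
open import Data.List.Relation.Unary.All using ([]; _∷_)
open import Data.List.Extrema.Nat using (max; xs≤max)
import Data.List.Relation.Unary.All as All
import Data.List.Relation.Unary.All.Properties as All
open import Data.List.Relation.Unary.Linked using (Linked; []; [-]; _∷_)
import Data.List.Relation.Unary.Linked as Linked
import Data.List.Relation.Unary.Linked.Properties as Linked
open import Data.List.Relation.Unary.Unique.Propositional using (Unique; []; _∷_)
open import Data.List.Relation.Unary.Unique.Propositional.Properties using (++⁺)
import Data.List.Relation.Unary.Unique.Propositional.Properties as Unique
open import Data.List.Relation.Binary.Permutation.Propositional using (↭-sym; ↭⇒↭ₛ)
open import Data.List.Relation.Binary.Permutation.Propositional.Properties using (↭-reverse)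
import Data.List.Relation.Binary.Permutation.Setoid.Properties as Permutation
open import Data.Empty using (⊥; ⊥-elim)
open import Relation.Binary.PropositionalEquality hiding ([_])
open import Relation.Nullary using (¬_; Dec; yes; no; ¬?; _×-dec_; _⊎-dec_)
open import Function.Base using (_∘_; id)
open import Function.Bundles using (Equivalence; mk⇔)

module _ {X : Set} where

  last-∷ʳ : ∀ (xs : List X) y → last (xs ∷ʳ y) ≡ just y
  last-∷ʳ []           y = refl
  last-∷ʳ (_ ∷ [])     y = refl
  last-∷ʳ (_ ∷ x ∷ xs) y = last-∷ʳ (x ∷ xs) y

  last-++-∷ : ∀ (xs : List X) y ys → last (xs ++ y ∷ ys) ≡ last (y ∷ ys)
  last-++-∷ []           y ys = refl
  last-++-∷ (_ ∷ [])     y ys = refl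
  last-++-∷ (_ ∷ x ∷ xs) y ys = last-++-∷ (x ∷ xs) y ys

  last-∷ : ∀ {xs : List X} {a} y → head xs ≡ just a → last (y ∷ xs) ≡ last xs
  last-∷ {_ ∷ _} y _ = refl

  last-++-∷ʳ : ∀ (xs ys : List X) y → last (xs ++ ys ∷ʳ y) ≡ just y
  last-++-∷ʳ xs ys y = trans (cong last (sym (++-assoc xs ys [ y ]))) (last-∷ʳ (xs ++ ys) y)

  head-++ : ∀ {xs : List X} {a} ys → head xs ≡ just a → head (xs ++ ys) ≡ just a
  head-++ {_ ∷ _} ys e = e

  head⇒∈ : ∀ {xs : List X} {a} → head xs ≡ just a → a ∈ xs
  head⇒∈ {_ ∷ _} e = here (sym (just-injective e))

  last⇒∈ : ∀ {xs : List X} {a} → last xs ≡ just a → a ∈ xs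
  last⇒∈ {_ ∷ []}     e = here (sym (just-injective e))
  last⇒∈ {_ ∷ _ ∷ _} e = there (last⇒∈ e)

  head⇒∷ : ∀ {xs : List X} {a} → head xs ≡ just a → ∃ λ ys → xs ≡ a ∷ ys
  head⇒∷ {_ ∷ ys} refl = ys , refl

  last⇒∷ʳ : ∀ {xs : List X} {a} → last xs ≡ just a → ∃ λ ys → xs ≡ ys ∷ʳ a
  last⇒∷ʳ {_ ∷ []}      refl = [] , refl
  last⇒∷ʳ {x ∷ _ ∷ _} e with last⇒∷ʳ e
  ... | ys , eq = x ∷ ys , cong (x ∷_) eq

  ∃-last : ∀ (x : X) xs → ∃ λ l → last (x ∷ xs) ≡ just l
  ∃-last x []       = x , refl
  ∃-last _ (x ∷ xs) = ∃-last x xs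

  ∃-head-∷ʳ : ∀ (xs : List X) y → ∃ λ h → head (xs ∷ʳ y) ≡ just h
  ∃-head-∷ʳ []      y = y , refl
  ∃-head-∷ʳ (x ∷ _) _ = x , refl

  head-++-∷ : ∀ (xs : List X) y ys → head (xs ++ y ∷ ys) ≡ head (xs ∷ʳ y)
  head-++-∷ []      y ys = refl
  head-++-∷ (_ ∷ _) y ys = refl

  head-reverse : ∀ (xs : List X) {a} → last xs ≡ just a → head (reverse xs) ≡ just a
  head-reverse xs e with last⇒∷ʳ {xs} e
  ... | ys , refl = cong head (reverse-++ ys [ _ ])

  last-reverse : ∀ (xs : List X) {a} → head xs ≡ just a → last (reverse xs) ≡ just a
  last-reverse xs e with head⇒∷ {xs} e
  ... | ys , refl = trans (cong last (unfold-reverse _ ys)) (last-∷ʳ (reverse ys) _)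

  Unique-reverse : ∀ {xs : List X} → Unique xs → Unique (reverse xs)
  Unique-reverse {xs} = Permutation.Unique-resp-↭ (setoid X) (↭⇒↭ₛ (↭-sym (↭-reverse xs)))

  Unique-++⁻ˡ : ∀ (xs : List X) {ys} → Unique (xs ++ ys) → Unique xs
  Unique-++⁻ˡ []       u = []
  Unique-++⁻ˡ (x ∷ xs) (x∉ ∷ u) = All.++⁻ˡ xs x∉ ∷ Unique-++⁻ˡ xs u

  Unique-prefix : ∀ (xs : List X) {y ys} → Unique (xs ++ y ∷ ys) → Unique (xs ∷ʳ y)
  Unique-prefix xs {y} {ys} u = Unique-++⁻ˡ (xs ∷ʳ y) (subst Unique (sym (++-assoc xs [ y ] ys)) u)

  Unique-++⁻ʳ : ∀ (xs : List X) {ys} → Unique (xs ++ ys) → Unique ys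
  Unique-++⁻ʳ []       u       = u
  Unique-++⁻ʳ (_ ∷ xs) (_ ∷ u) = Unique-++⁻ʳ xs u

  Unique-++⁻-disjoint : ∀ (xs : List X) {ys z} → Unique (xs ++ ys) → z ∈ xs → z ∉ ys
  Unique-++⁻-disjoint (x ∷ xs) (x∉ ∷ _) (here refl) z∈ys = All.lookup (All.++⁻ʳ xs x∉) z∈ys refl
  Unique-++⁻-disjoint (x ∷ xs) (_ ∷ u)  (there z∈xs) = Unique-++⁻-disjoint xs u z∈xs

module _ {X : Set} {R : X → X → Set} where

  Linked-++ : ∀ {xs ys : List X} {a b} → last xs ≡ just a → head ys ≡ just b → R a b →
              Linked R xs → Linked R ys → Linked R (xs ++ ys)
  Linked-++ ea eb r lxs lys = Linked.++⁺ lxs (subst₂ (Maybe.Connected R) (sym ea) (sym eb) (Maybe.just r)) lys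

  Linked-head : ∀ {x} {xs : List X} {b} → head xs ≡ just b → Linked R (x ∷ xs) → R x b
  Linked-head {xs = _ ∷ _} refl (r ∷ _) = r

  Linked-prefix : ∀ (xs : List X) {y ys} → Linked R (xs ++ y ∷ ys) → Linked R (xs ∷ʳ y)
  Linked-prefix []           _       = [-]
  Linked-prefix (_ ∷ [])     (r ∷ _) = r ∷ [-]
  Linked-prefix (_ ∷ x ∷ xs) (r ∷ l) = r ∷ Linked-prefix (x ∷ xs) l

  Linked-join : ∀ (xs : List X) {y ys} → Linked R (xs ∷ʳ y) → Linked R (y ∷ ys) → Linked R (xs ++ y ∷ ys)
  Linked-join []           _       l′ = l′
  Linked-join (_ ∷ [])     (r ∷ _) l′ = r ∷ l′
  Linked-join (_ ∷ x ∷ xs) (r ∷ l) l′ = r ∷ Linked-join (x ∷ xs) l l′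

  Linked-++⁻ʳ : ∀ (xs : List X) {ys} → Linked R (xs ++ ys) → Linked R ys
  Linked-++⁻ʳ []       l = l
  Linked-++⁻ʳ (_ ∷ xs) l = Linked-++⁻ʳ xs (Linked.tail l)

  Linked-reverse : (∀ {a b} → R a b → R b a) → ∀ {xs} → Linked R xs → Linked R (reverse xs)
  Linked-reverse R-sym {[]}         _       = []
  Linked-reverse R-sym {_ ∷ []}     _       = [-]
  Linked-reverse R-sym {x ∷ y ∷ xs} (r ∷ l) =
    subst (Linked R) (sym (unfold-reverse x (y ∷ xs)))
      (Linked-++ (last-reverse (y ∷ xs) refl) refl (R-sym r) (Linked-reverse R-sym l) [-])

  Linked-glue : ∀ {xs ys : List X} {t} → last xs ≡ just t → Linked R xs → Linked R (t ∷ ys) → Linked R (xs ++ ys)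
  Linked-glue {xs} {ys} {t} e lxs lys with last⇒∷ʳ {xs = xs} e
  ... | K , refl = subst (Linked R) (sym (++-assoc K [ t ] ys)) (Linked-join K lxs lys)

  Linked-cons : ∀ {p} {xs : List X} {h} → head xs ≡ just h → R p h → Linked R xs → Linked R (p ∷ xs)
  Linked-cons {xs = _ ∷ _} refl r l = r ∷ l

module _ {X Y : Set} (f : X → List Y) where

  concatMap-split : ∀ {x xs} → x ∈ xs → ∃₂ λ pre post → concatMap f xs ≡ pre ++ f x ++ post
  concatMap-split {xs = _ ∷ xs} (here refl) = [] , concatMap f xs , refl
  concatMap-split {xs = y ∷ _} (there x∈) with concatMap-split x∈
  ... | pre , post , e = f y ++ pre , post , trans (cong (f y ++_) e) (sym (++-assoc (f y) pre _))

  ∈-concatMap-find : ∀ {z xs} → z ∈ concatMap f xs → ∃ λ x → x ∈ xs × z ∈ f x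
  ∈-concatMap-find {xs = xs} z∈ = find (∈-concatMap⁻ f {xs = xs} z∈)

  ∈-concatMap : ∀ {x z xs} → x ∈ xs → z ∈ f x → z ∈ concatMap f xs
  ∈-concatMap x∈ z∈ = ∈-concatMap⁺ f (lose x∈ z∈)

  Unique-concatMap : ∀ {xs} → (∀ {x} → x ∈ xs → Unique (f x)) →
    (∀ {x y z} → x ∈ xs → y ∈ xs → z ∈ f x → z ∈ f y → x ≡ y) → Unique xs → Unique (concatMap f xs)
  Unique-concatMap {[]}     _      _        _          = []
  Unique-concatMap {x ∷ xs} unique disjoint (x∉ ∷ uxs) =
    ++⁺ (unique (here refl)) (Unique-concatMap (unique ∘ there) (λ x∈ y∈ → disjoint (there x∈) (there y∈)) uxs)
      λ { (z∈fx , z∈rest) → let y , y∈ , z∈fy = ∈-concatMap-find z∈rest in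
            All.lookup x∉ y∈ (disjoint (here refl) (there y∈) z∈fx z∈fy) }

  module _ {R : Y → Y → Set} (s t : X → Y) where

    -- Q p means that rest may follow p.
    Linked-concatMap : ∀ {xs} {Q : Y → Set} {rest} → Unique xs →
      (∀ {x} → x ∈ xs → Linked R (f x) × head (f x) ≡ just (s x) × last (f x) ≡ just (t x)) →
      (∀ {x y} → x ∈ xs → y ∈ xs → x ≢ y → R (t x) (s y)) → (∀ {x} → x ∈ xs → Q (t x)) →
      (∀ {p} → Q p → Linked R (p ∷ rest)) →
      ∀ {p} → (∀ {x} → x ∈ xs → R p (s x)) → Q p → Linked R (p ∷ concatMap f xs ++ rest)
    Linked-concatMap {[]} _ _ _ _ continue _ Qp = continue Qp
    Linked-concatMap {x ∷ xs} {rest = rest} (x∉ ∷ uxs) walk joins Q-end continue p→ Qp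
      with walk (here refl)
    ... | lx , hx , ex =
      Linked-cons (head-++ rest (head-++ (concatMap f xs) hx)) (p→ (here refl))
        (subst (Linked R) (sym (++-assoc (f x) (concatMap f xs) rest))
          (Linked-glue ex lx
            (Linked-concatMap uxs (walk ∘ there) (λ x∈ y∈ → joins (there x∈) (there y∈)) (Q-end ∘ there) continue
              (λ y∈ → joins (here refl) (there y∈) λ { refl → All.lookup x∉ y∈ refl }) (Q-end (here refl)))))

-- Paths in graphs

module Paths {n : ℕ} (R : Rel n) where
  open import Data.List.Membership.DecPropositional (_≟ᶠ_ {n}) using (_∈?_)

  PathBetween-reverse : (∀ {a b} → R a b → R b a) → ∀ {u v P} → PathBetween R u v P → PathBetween R v u (reverse P)
  PathBetween-reverse R-sym {P = P} ((l , uq) , h , e) =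
    (Linked-reverse R-sym l , Unique-reverse uq) , head-reverse P e , last-reverse P h

  edge-path : ∀ {u v} → u ≢ v → R u v → PathBetween R u v (u ∷ v ∷ [])
  edge-path u≢v r = (r ∷ [-] , (u≢v ∷ []) ∷ [] ∷ []) , refl , refl

  walk⇒path : ∀ {W a b} → Linked R W → head W ≡ just a → last W ≡ just b → ∃ λ P → PathBetween R a b P
  walk⇒path {w ∷ []} l h e = w ∷ [] , ([-] , [] ∷ []) , h , e
  walk⇒path {w ∷ w′ ∷ W} (r ∷ l) h e with walk⇒path l refl e
  ... | P , (lP , uP) , hP , eP with w ∈? P
  ...   | yes w∈P with ∈-∃++ w∈P
  ...     | K , L , refl = w ∷ L , (Linked-++⁻ʳ K lP , Unique-++⁻ʳ K uP) , h , trans (sym (last-++-∷ K w L)) eP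
  walk⇒path {w ∷ w′ ∷ W} (r ∷ l) h e | p ∷ P , (lP , uP) , refl , eP | no w∉P =
    w ∷ p ∷ P , (r ∷ lP , All.¬Any⇒All¬ _ w∉P ∷ uP) , h , eP

  first-common : ∀ (xs ys : List (Fin n)) → Any (_∈ ys) xs →
    ∃ λ pre → ∃ λ w → ∃ λ post → xs ≡ pre ++ w ∷ post × w ∈ ys × (∀ {z} → z ∈ pre → z ∉ ys)
  first-common (x ∷ xs) ys a with x ∈? ys
  ... | yes x∈ys = [] , x , xs , refl , x∈ys , λ ()
  first-common (x ∷ xs) ys (here x∈ys)  | no x∉ys = ⊥-elim (x∉ys x∈ys)
  first-common (x ∷ xs) ys (there a)    | no x∉ys with first-common xs ys a
  ... | pre , w , post , refl , w∈ys , pre∉ys = x ∷ pre , w , post , refl , w∈ys , λ where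
    (here refl) → x∉ys
    (there z∈pre) → pre∉ys z∈pre

  module Acyclic (R-sym : ∀ {a b} → R a b → R b a) (acyclic : ∀ C → ¬ IsCycle R C) where

    -- Following the first branch up to where it meets the second, then the second back, closes a cycle.
    no-fork : ∀ {u w p q A B} → p ≢ q → head A ≡ just p → head B ≡ just q →
              PathBetween R u w (u ∷ A) → PathBetween R u w (u ∷ B) → ⊥
    no-fork {u} {w} {p} {q} {A} {B} p≢q hA hB ((lA , u∉A ∷ uA) , _ , eA) ((lB , u∉B ∷ uB) , _ , eB)
      with first-common A B (lose (last⇒∈ (trans (sym (last-∷ u hA)) eA)) (last⇒∈ (trans (sym (last-∷ u hB)) eB)))
    ... | pre , c , post , refl , c∈B , pre∉B with ∈-∃++ c∈B
    ... | B₁ , B₂ , refl =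
      acyclic C ((lC , uC) , 3≤|C| pre B₁ hA hB , u , q , refl , lastC , R-sym (Linked-head hB lB))
      where
        C : List (Fin n)
        C = u ∷ pre ++ c ∷ reverse B₁
        back : reverse (B₁ ∷ʳ c) ≡ c ∷ reverse B₁
        back = reverse-++ B₁ [ c ]
        lC : Linked R C
        lC = Linked-join (u ∷ pre) (Linked-prefix (u ∷ pre) lA)
               (subst (Linked R) back (Linked-reverse R-sym (Linked-prefix B₁ (Linked.tail lB))))
        uC : Unique C
        uC = All.¬Any⇒All¬ _ u∉C ∷ ++⁺ (Unique-++⁻ˡ pre uA)
               (subst Unique back (Unique-reverse (Unique-prefix B₁ uB))) disjoint
          where
            u∉C : u ∉ pre ++ c ∷ reverse B₁
            u∉C u∈C with ∈-++⁻ pre u∈C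
            ... | inj₁ u∈pre        = All.lookup u∉A (∈-++⁺ˡ u∈pre) refl
            ... | inj₂ (here refl)  = All.lookup u∉A (∈-++⁺ʳ pre (here refl)) refl
            ... | inj₂ (there u∈B₁) = All.lookup u∉B (∈-++⁺ˡ (Any.reverse⁻ {xs = B₁} u∈B₁)) refl
            disjoint : ∀ {z} → ¬ (z ∈ pre × z ∈ c ∷ reverse B₁)
            disjoint (z∈pre , here refl)    = Unique-++⁻-disjoint pre uA z∈pre (here refl)
            disjoint (z∈pre , there z∈B₁)   = pre∉B z∈pre (∈-++⁺ˡ (Any.reverse⁻ {xs = B₁} z∈B₁))
        3≤|C| : ∀ pre′ B₁′ → head (pre′ ++ c ∷ post) ≡ just p → head (B₁′ ++ c ∷ B₂) ≡ just q →
                3 ≤ length (u ∷ pre′ ++ c ∷ reverse B₁′)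
        3≤|C| [] [] refl refl = ⊥-elim (p≢q refl)
        3≤|C| [] (b ∷ B₁′) _ _ = subst (3 ≤_) (cong (2 +_) (sym (length-reverse (b ∷ B₁′)))) (s≤s (s≤s (s≤s z≤n)))
        3≤|C| (_ ∷ pre′) _ _ _ =
          s≤s (s≤s (subst (1 ≤_) (sym (length-++ pre′)) (≤-trans (s≤s z≤n) (m≤n+m _ (length pre′)))))
        lastC : last C ≡ just q
        lastC = begin
          last C                    ≡⟨ last-++-∷ (u ∷ pre) c (reverse B₁) ⟩
          last (c ∷ reverse B₁)     ≡⟨ cong last (sym back) ⟩
          last (reverse (B₁ ∷ʳ c))  ≡⟨ last-reverse (B₁ ∷ʳ c) (trans (sym (head-++-∷ B₁ c B₂)) hB) ⟩
          just q                    ∎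
          where open ≡-Reasoning

    path-unique : ∀ {u v P Q} → PathBetween R u v P → PathBetween R u v Q → P ≡ Q
    path-unique = unique-from _ _
      where
      unique-from : ∀ P Q {u v} → PathBetween R u v P → PathBetween R u v Q → P ≡ Q
      unique-from (_ ∷ []) (_ ∷ []) (_ , refl , _) (_ , refl , _) = refl
      unique-from (_ ∷ []) (_ ∷ q ∷ Q) (_ , refl , refl) ((_ , u∉Q ∷ _) , refl , e) =
        ⊥-elim (All.lookup u∉Q (last⇒∈ e) refl)
      unique-from (_ ∷ p ∷ P) (_ ∷ []) ((_ , u∉P ∷ _) , refl , e) (_ , refl , refl) =
        ⊥-elim (All.lookup u∉P (last⇒∈ e) refl)
      unique-from (u ∷ p ∷ P) (_ ∷ q ∷ Q) πP@((_ ∷ lP , _ ∷ uP) , refl , eP) πQ@((_ ∷ lQ , _ ∷ uQ) , refl , eQ) =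
        cong (u ∷_) (unique-from (p ∷ P) (q ∷ Q) ((lP , uP) , refl , eP) ((lQ , uQ) , cong just (sym p≡q) , eQ))
        where
        p≡q : p ≡ q
        p≡q with p ≟ᶠ q
        ... | yes p≡q = p≡q
        ... | no p≢q  = ⊥-elim (no-fork p≢q refl refl πP πQ)

-- Rooted trees

module RootedTree {n : ℕ} (T : Graph n) (tree : IsTree T) (root : Fin n) where
  open Paths (Adj T) public
  open Acyclic (Graph.sym T) (proj₂ tree) public
  open import Data.List.Membership.DecPropositional (_≟ᶠ_ {n}) using (_∈?_)

  rootPath : Fin n → List (Fin n)
  rootPath z = proj₁ (proj₁ tree root z)

  rootPath-between : ∀ z → PathBetween (Adj T) root z (rootPath z)
  rootPath-between z = proj₂ (proj₁ tree root z)

  rootPath-Linked : ∀ z → Linked (Adj T) (rootPath z)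
  rootPath-Linked z = proj₁ (proj₁ (rootPath-between z))

  rootPath-Unique : ∀ z → Unique (rootPath z)
  rootPath-Unique z = proj₂ (proj₁ (rootPath-between z))

  rootPath-head : ∀ z → head (rootPath z) ≡ just root
  rootPath-head z = proj₁ (proj₂ (rootPath-between z))

  rootPath-last : ∀ z → last (rootPath z) ≡ just z
  rootPath-last z = proj₂ (proj₂ (rootPath-between z))

  rootPath-≡ : ∀ {z P} → PathBetween (Adj T) root z P → rootPath z ≡ P
  rootPath-≡ = path-unique (rootPath-between _)

  rootPath-injective : ∀ {u v} → rootPath u ≡ rootPath v → u ≡ v
  rootPath-injective {u} {v} e = just-injective (trans (sym (rootPath-last u)) (trans (cong last e) (rootPath-last v)))

  rootPath-prefix : ∀ {z} K c s → rootPath z ≡ K ++ c ∷ s → rootPath c ≡ K ∷ʳ c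
  rootPath-prefix {z} K c s e with subst (PathBetween (Adj T) root z) e (rootPath-between z)
  ... | (l , u) , h , _ =
    rootPath-≡ ((Linked-prefix K l , Unique-prefix K u) , trans (sym (head-++-∷ K c s)) h , last-∷ʳ K c)

  rootPath-root : rootPath root ≡ [ root ]
  rootPath-root = rootPath-≡ (([-] , [] ∷ []) , refl , refl)

  depth : Fin n → ℕ
  depth z = length (rootPath z)

  _≼_ : Fin n → Fin n → Set
  a ≼ z = ∃ λ s → rootPath z ≡ rootPath a ++ s

  Child : Fin n → Fin n → Set
  Child a c = rootPath c ≡ rootPath a ∷ʳ c

  ≼-refl : ∀ {a} → a ≼ a
  ≼-refl {a} = [] , sym (++-identityʳ (rootPath a))

  ≼-trans : ∀ {a b z} → a ≼ b → b ≼ z → a ≼ z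
  ≼-trans {a} (s₁ , e₁) (s₂ , e₂) = s₁ ++ s₂ , trans e₂ (trans (cong (_++ s₂) e₁) (++-assoc (rootPath a) s₁ s₂))

  Child⇒≼ : ∀ {a c} → Child a c → a ≼ c
  Child⇒≼ e = [ _ ] , e

  root-≼ : ∀ z → root ≼ z
  root-≼ z with head⇒∷ (rootPath-head z)
  ... | Z , e = Z , trans e (cong (_++ Z) (sym rootPath-root))

  ≼⇒depth≤ : ∀ {a z} → a ≼ z → depth a ≤ depth z
  ≼⇒depth≤ {a} (s , e) = subst (depth a ≤_) (sym (trans (cong length e) (length-++ (rootPath a)))) (m≤m+n _ _)

  depth-Child : ∀ {a c} → Child a c → depth c ≡ suc (depth a)
  depth-Child {a} {c} e = trans (cong length e) (trans (length-++ (rootPath a)) (+-comm (depth a) 1))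

  ≼∧depth≤⇒≡ : ∀ {a z} → a ≼ z → depth z ≤ depth a → a ≡ z
  ≼∧depth≤⇒≡ {a} ([] , e) _ = sym (rootPath-injective (trans e (++-identityʳ (rootPath a))))
  ≼∧depth≤⇒≡ {a} (w ∷ s , e) z≤a = ⊥-elim (<-irrefl refl (≤-trans a<z z≤a))
    where
    a<z : depth a < _
    a<z = subst (depth a <_) (sym (trans (cong length e) (length-++ (rootPath a)))) (m<m+n _ (s≤s z≤n))

  ≼-antisym : ∀ {a z} → a ≼ z → z ≼ a → a ≡ z
  ≼-antisym a≼z z≼a = ≼∧depth≤⇒≡ a≼z (≼⇒depth≤ z≼a)

  Child⇒≢ : ∀ {p c z} → Child p c → c ≼ z → p ≢ z
  Child⇒≢ p→c c≼z refl = <-irrefl refl (≤-trans (≤-reflexive (sym (depth-Child p→c))) (≼⇒depth≤ c≼z))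

  ≼-step : ∀ {a z} → a ≼ z → z ≢ a → ∃ λ c → Child a c × c ≼ z
  ≼-step {a} ([] , e) z≢a = ⊥-elim (z≢a (rootPath-injective (trans e (++-identityʳ (rootPath a)))))
  ≼-step {a} (c ∷ s , e) _ =
    c , a→c , s , trans e (trans (sym (++-assoc (rootPath a) [ c ] s)) (cong (_++ s) (sym a→c)))
    where
    a→c : Child a c
    a→c = rootPath-prefix (rootPath a) c s e

  ∈-rootPath⇒≼ : ∀ {c z} → c ∈ rootPath z → c ≼ z
  ∈-rootPath⇒≼ {c} c∈ with ∈-∃++ c∈
  ... | K , L , e = L , trans e (trans (sym (++-assoc K [ c ] L)) (cong (_++ L) (sym (rootPath-prefix K c L e))))

  siblings-disjoint : ∀ {a c₁ c₂ z} → Child a c₁ → Child a c₂ → c₁ ≼ z → c₂ ≼ z → c₁ ≡ c₂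
  siblings-disjoint {a} {c₁} {c₂} e₁ e₂ (s₁ , f₁) (s₂ , f₂) =
    just-injective (cong head (++-cancelˡ (rootPath a) (c₁ ∷ s₁) (c₂ ∷ s₂) (begin
      rootPath a ++ c₁ ∷ s₁       ≡⟨ sym (++-assoc (rootPath a) [ c₁ ] s₁) ⟩
      (rootPath a ∷ʳ c₁) ++ s₁    ≡⟨ cong (_++ s₁) (sym e₁) ⟩
      rootPath c₁ ++ s₁           ≡⟨ trans (sym f₁) f₂ ⟩
      rootPath c₂ ++ s₂           ≡⟨ cong (_++ s₂) e₂ ⟩
      (rootPath a ∷ʳ c₂) ++ s₂    ≡⟨ ++-assoc (rootPath a) [ c₂ ] s₂ ⟩
      rootPath a ++ c₂ ∷ s₂       ∎)))
    where open ≡-Reasoning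

  parent-unique : ∀ {p q c} → Child p c → Child q c → p ≡ q
  parent-unique {p} {q} e₁ e₂ = rootPath-injective (proj₁ (∷ʳ-injective (rootPath p) (rootPath q) (trans (sym e₁) e₂)))

  between-Child : ∀ {r c m} → r ≼ c → Child r m → c ≼ m → c ≡ r ⊎ c ≡ m
  between-Child {r} {c} r≼c r→m c≼m with depth c ≤? depth r
  ... | yes c≤r = inj₁ (sym (≼∧depth≤⇒≡ r≼c c≤r))
  ... | no c≰r  = inj₂ (≼∧depth≤⇒≡ c≼m (subst (_≤ depth c) (sym (depth-Child r→m)) (≰⇒> c≰r)))

  Child⇒Adj : ∀ {a c} → Child a c → Adj T a c
  Child⇒Adj {a} {c} e with last⇒∷ʳ (rootPath-last a)
  ... | K , e′ = Linked.head (Linked-++⁻ʳ K (subst (Linked (Adj T)) path (rootPath-Linked c)))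
    where
    path : rootPath c ≡ K ++ a ∷ c ∷ []
    path = trans e (trans (cong (_∷ʳ c) e′) (++-assoc K [ a ] [ c ]))

  rootPath-extend : ∀ {u v} → Adj T u v → v ∉ rootPath u → Child u v
  rootPath-extend {u} {v} r v∉ = rootPath-≡
    ((Linked-++ (rootPath-last u) refl r (rootPath-Linked u) [-] ,
      ++⁺ (rootPath-Unique u) ([] ∷ []) λ { (v∈ , here refl) → v∉ v∈ }) ,
     head-++ [ v ] (rootPath-head u) , last-∷ʳ (rootPath u) v)

  Adj⇒Child : ∀ {u v} → Adj T u v → Child u v ⊎ Child v u
  Adj⇒Child {u} {v} r with v ∈? rootPath u
  ... | no v∉ = inj₁ (rootPath-extend r v∉)
  ... | yes v∈ with ∈-∃++ v∈
  ...   | K , L , e = inj₂ (begin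
          rootPath u        ≡⟨ e ⟩
          K ++ v ∷ L        ≡⟨ cong (λ t → K ++ v ∷ t) L≡u ⟩
          K ++ v ∷ u ∷ []   ≡⟨ sym (++-assoc K [ v ] [ u ]) ⟩
          (K ∷ʳ v) ∷ʳ u     ≡⟨ cong (_∷ʳ u) (sym (rootPath-prefix K v L e)) ⟩
          rootPath v ∷ʳ u   ∎)
    where
    open ≡-Reasoning
    suffix : PathBetween (Adj T) v u (v ∷ L)
    suffix with subst (PathBetween (Adj T) root u) e (rootPath-between u)
    ... | (l , uq) , _ , lst = (Linked-++⁻ʳ K l , Unique-++⁻ʳ K uq) , refl , trans (sym (last-++-∷ K v L)) lst
    L≡u : L ≡ [ u ]
    L≡u = cong (drop 1) (path-unique suffix (edge-path (λ { refl → Graph.irefl T r }) (Graph.sym T r)))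

  Child? : ∀ a c → Dec (Child a c)
  Child? a c = ≡-dec _≟ᶠ_ (rootPath c) (rootPath a ∷ʳ c)

  _≼?_ : ∀ a z → Dec (a ≼ z)
  a ≼? z = prefix? (rootPath a) (rootPath z)
    where
    prefix? : (K L : List (Fin n)) → Dec (∃ λ s → L ≡ K ++ s)
    prefix? [] L = yes (L , refl)
    prefix? (k ∷ K) [] = no λ ()
    prefix? (k ∷ K) (l ∷ L) with l ≟ᶠ k | prefix? K L
    ... | yes refl | yes (s , e) = yes (s , cong (l ∷_) e)
    ... | yes refl | no ¬pre     = no λ { (s , refl) → ¬pre (s , refl) }
    ... | no l≢k   | _           = no λ { (s , refl) → l≢k refl }

  Linked-avoiding : ∀ {u v L} → Linked (Adj T) L → v ∉ L → Linked (AdjMinus T u v) L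
  Linked-avoiding []      _   = []
  Linked-avoiding [-]     _   = [-]
  Linked-avoiding (r ∷ l) v∉L =
    (r , λ { (inj₁ (_ , refl)) → v∉L (there (here refl)) ; (inj₂ (refl , _)) → v∉L (here refl) })
    ∷ Linked-avoiding l (λ v∈ → v∉L (there v∈))

  AdjMinus-sym : ∀ {u v a b} → AdjMinus T u v a b → AdjMinus T u v b a
  AdjMinus-sym (r , ¬uv) =
    Graph.sym T r , λ { (inj₁ (e₁ , e₂)) → ¬uv (inj₂ (e₂ , e₁)) ; (inj₂ (e₁ , e₂)) → ¬uv (inj₁ (e₂ , e₁)) }

  AdjMinus-flip : ∀ {u v a b} → AdjMinus T u v a b → AdjMinus T v u a b
  AdjMinus-flip (r , ¬uv) = r , λ { (inj₁ e) → ¬uv (inj₂ e) ; (inj₂ e) → ¬uv (inj₁ e) }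

  ≼⇒Side : ∀ {p c z} → Child p c → c ≼ z → Side T c p z
  ≼⇒Side {p} {c} {z} p→c (s , e)
    with subst (PathBetween (Adj T) root z) (trans e (trans (cong (_++ s) p→c) (++-assoc (rootPath p) [ c ] s)))
               (rootPath-between z)
  ... | (l , uq) , _ , lst = c ∷ s ,
      (Linked-avoiding (Linked-++⁻ʳ (rootPath p) l) (Unique-++⁻-disjoint (rootPath p) uq (last⇒∈ (rootPath-last p))) ,
       Unique-++⁻ʳ (rootPath p) uq) ,
      refl , trans (sym (last-++-∷ (rootPath p) c s)) lst

  ⋠⇒Side : ∀ {p c z} → Child p c → ¬ c ≼ z → Side T p c z
  ⋠⇒Side {p} {c} {z} p→c c⋠z with head⇒∷ (rootPath-head p) | head⇒∷ (rootPath-head z)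
  ... | P , eP | Z , eZ = Paths.walk⇒path (AdjMinus T p c) lW hW lastW
    where
    W : List (Fin n)
    W = reverse P ++ root ∷ Z
    c∉z : c ∉ rootPath z
    c∉z = c⋠z ∘ ∈-rootPath⇒≼
    c∉p : c ∉ rootPath p
    c∉p c∈ = Unique-++⁻-disjoint (rootPath p) (subst Unique p→c (rootPath-Unique c)) c∈ (here refl)
    toRoot : Linked (AdjMinus T p c) (reverse P ∷ʳ root)
    toRoot = subst (Linked (AdjMinus T p c)) (unfold-reverse root P)
               (Linked-reverse AdjMinus-sym (subst (Linked (AdjMinus T p c)) eP
                 (Linked-avoiding (rootPath-Linked p) c∉p)))
    lW : Linked (AdjMinus T p c) W
    lW = Linked-join (reverse P) toRoot
           (subst (Linked (AdjMinus T p c)) eZ (Linked-avoiding (rootPath-Linked z) c∉z))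
    hW : head W ≡ just p
    hW = begin
      head (reverse P ++ root ∷ Z)   ≡⟨ head-++-∷ (reverse P) root Z ⟩
      head (reverse P ∷ʳ root)       ≡⟨ cong head (sym (unfold-reverse root P)) ⟩
      head (reverse (root ∷ P))      ≡⟨ head-reverse (root ∷ P) (trans (cong last (sym eP)) (rootPath-last p)) ⟩
      just p                         ∎
      where open ≡-Reasoning
    lastW : last W ≡ just z
    lastW = trans (last-++-∷ (reverse P) root Z) (trans (cong last (sym eZ)) (rootPath-last z))

  sides-disjoint : ∀ {p c z} → Child p c → Side T c p z → Side T p c z → ⊥
  sides-disjoint {p} {c} {z} p→c (Q₁ , (l₁ , _) , h₁ , e₁) (Q₂ , (l₂ , _) , h₂ , e₂)
    with last⇒∷ʳ {xs = Q₁} e₁ | head⇒∷ (head-reverse Q₂ e₂)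
  ... | K , refl | L , eL = no-path (Paths.walk⇒path (AdjMinus T c p) lW hW lastW)
    where
    lW : Linked (AdjMinus T c p) (K ++ z ∷ L)
    lW = Linked-join K l₁
      (subst (Linked (AdjMinus T c p)) eL (Linked-reverse AdjMinus-sym (Linked.map AdjMinus-flip l₂)))
    hW : head (K ++ z ∷ L) ≡ just c
    hW = trans (head-++-∷ K z L) h₁
    lastW : last (K ++ z ∷ L) ≡ just p
    lastW = trans (last-++-∷ K z L) (trans (cong last (sym eL)) (last-reverse Q₂ h₂))
    no-path : (∃ λ P → PathBetween (AdjMinus T c p) c p P) → ⊥
    no-path (P , (lP , uP) , hP , eP)
      with path-unique ((Linked.map proj₁ lP , uP) , hP , eP)
                       (edge-path (λ c≡p → Child⇒≢ p→c ≼-refl (sym c≡p)) (Graph.sym T (Child⇒Adj p→c)))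
    ... | refl = proj₂ (Linked.head lP) (inj₁ (refl , refl))

-- Counting crossings

module _ {n : ℕ} {A B : Fin n → Set} where

  ContainsExactly-swap : ∀ {F k} → ContainsExactly A B F k → ContainsExactly B A F k
  ContainsExactly-swap (L , uL , |L| , L⇔) = L , uL , |L| , λ i j → mk⇔
    (λ ij∈L → swap-ends (Equivalence.to (L⇔ i j) ij∈L))
    (λ ends → Equivalence.from (L⇔ i j) (swap-ends ends))
    where
    swap-ends : ∀ {P Q : Set} {X Y : Set} → P × Q × (X ⊎ Y) → P × Q × (Y ⊎ X)
    swap-ends (p , q , xy) = p , q , Data.Sum.swap xy

  ABPath-pair⇒ : ∀ {u v} → IsABPath A B (u ∷ v ∷ []) → A u × B v
  ABPath-pair⇒ (_ , _ , [] , refl , a , b , _) = a , b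
  ABPath-pair⇒ (_ , _ , _ ∷ [] , () , _)
  ABPath-pair⇒ (_ , _ , _ ∷ _ ∷ _ , () , _)

  ABPath-pair⇐ : ∀ {u v} → (∀ {z} → A z → B z → ⊥) → A u → B v → IsABPath A B (u ∷ v ∷ [])
  ABPath-pair⇐ {u} {v} A∩B=∅ a b = u , v , [] , refl , a , b ,
    (λ { _ (here refl) _ → refl ; _ (there (here refl)) a′ → ⊥-elim (A∩B=∅ a′ b) }) ,
    (λ { _ (here refl) b′ → ⊥-elim (A∩B=∅ a b′) ; _ (there (here refl)) _ → refl })

  -- The middle vertex lies in A or in B, so it would have to be an end.
  ¬ABPath-long : ∀ {u v w L} → (∀ z → A z ⊎ B z) → Unique (u ∷ v ∷ w ∷ L) → ¬ IsABPath A B (u ∷ v ∷ w ∷ L)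
  ¬ABPath-long {v = v} {w} {L} A∪B (u∉ ∷ v∉ ∷ _) (a , b , mid , e , _ , _ , onlyA , onlyB) with A∪B v
  ... | inj₁ Av with just-injective (cong head e)
  ...   | refl = All.lookup u∉ (here refl) (sym (onlyA v (there (here refl)) Av))
  ¬ABPath-long {v = v} {w} {L} A∪B (u∉ ∷ v∉ ∷ _) (a , b , mid , e , _ , _ , onlyA , onlyB) | inj₂ Bv =
    All.lookup v∉ (subst (_∈ w ∷ L) (sym (onlyB v (there (here refl)) Bv)) b∈) refl
    where
    b∈ : b ∈ w ∷ L
    b∈ = last⇒∈ (trans (cong last e) (last-∷ʳ (a ∷ mid) b))

module Crossings {n : ℕ} {D : Fin n → Set} (D? : ∀ z → Dec (D z)) where

  Straddles : Fin n → Fin n → Set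
  Straddles u v = (D u × ¬ D v) ⊎ (¬ D u × D v)

  straddles? : ∀ u v → Dec (Straddles u v)
  straddles? u v = (D? u ×-dec ¬? (D? v)) ⊎-dec (¬? (D? u) ×-dec D? v)

  indicator : ∀ {P : Set} → Dec P → ℕ
  indicator (yes _) = 1
  indicator (no _)  = 0

  indicator-yes : ∀ {P : Set} (d : Dec P) → P → indicator d ≡ 1
  indicator-yes (yes _) _ = refl
  indicator-yes (no ¬p) p = ⊥-elim (¬p p)

  indicator-no : ∀ {P : Set} (d : Dec P) → ¬ P → indicator d ≡ 0
  indicator-no (yes p) ¬p = ⊥-elim (¬p p)
  indicator-no (no _)  _  = refl

  crossings : List (Fin n) → ℕ
  crossings []          = 0
  crossings (_ ∷ [])    = 0
  crossings (u ∷ v ∷ L) = indicator (straddles? u v) + crossings (v ∷ L)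

  crossings-++ : ∀ (K L : List (Fin n)) {k l} → last K ≡ just k → head L ≡ just l →
                 crossings (K ++ L) ≡ crossings K + indicator (straddles? k l) + crossings L
  crossings-++ (_ ∷ [])     (_ ∷ L) refl refl = refl
  crossings-++ (u ∷ v ∷ K) L ek el = begin
    indicator (straddles? u v) + crossings ((v ∷ K) ++ L)
      ≡⟨ cong (indicator (straddles? u v) +_) (crossings-++ (v ∷ K) L ek el) ⟩
    indicator (straddles? u v) + (crossings (v ∷ K) + _ + crossings L)
      ≡⟨ sym (+-assoc (indicator (straddles? u v)) _ (crossings L)) ⟩
    indicator (straddles? u v) + (crossings (v ∷ K) + _) + crossings L
      ≡⟨ cong (_+ crossings L) (sym (+-assoc (indicator (straddles? u v)) _ _)) ⟩
    crossings (u ∷ v ∷ K) + _ + crossings L ∎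
    where open ≡-Reasoning

  crossings-homogeneous : ∀ (L : List (Fin n)) → (∀ {u v} → u ∈ L → v ∈ L → ¬ Straddles u v) → crossings L ≡ 0
  crossings-homogeneous []          _     = refl
  crossings-homogeneous (_ ∷ [])    _     = refl
  crossings-homogeneous (u ∷ v ∷ L) ¬cross =
    cong₂ _+_ (indicator-no (straddles? u v) (¬cross (here refl) (there (here refl))))
              (crossings-homogeneous (v ∷ L) (λ u∈ v∈ → ¬cross (there u∈) (there v∈)))

  crossings-inside : ∀ (L : List (Fin n)) → (∀ {z} → z ∈ L → D z) → crossings L ≡ 0
  crossings-inside L inside = crossings-homogeneous L λ where
    u∈ v∈ (inj₁ (_ , ¬Dv)) → ¬Dv (inside v∈)
    u∈ v∈ (inj₂ (¬Du , _)) → ¬Du (inside u∈)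

  crossings-outside : ∀ (L : List (Fin n)) → (∀ {z} → z ∈ L → ¬ D z) → crossings L ≡ 0
  crossings-outside L outside = crossings-homogeneous L λ where
    u∈ v∈ (inj₁ (Du , _)) → outside u∈ Du
    u∈ v∈ (inj₂ (_ , Dv)) → outside v∈ Dv

  straddles-sym : ∀ {u v} → Straddles u v → Straddles v u
  straddles-sym = Data.Sum.swap ∘ Data.Sum.map Data.Product.swap Data.Product.swap

  indicator-straddles-sym : ∀ u v → indicator (straddles? u v) ≡ indicator (straddles? v u)
  indicator-straddles-sym u v with straddles? u v
  ... | yes s = sym (indicator-yes (straddles? v u) (straddles-sym s))
  ... | no ¬s = sym (indicator-no (straddles? v u) (¬s ∘ straddles-sym))

  crossings-reverse : ∀ (L : List (Fin n)) → crossings (reverse L) ≡ crossings L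
  crossings-reverse []          = refl
  crossings-reverse (_ ∷ [])    = refl
  crossings-reverse (u ∷ v ∷ L) = begin
    crossings (reverse (u ∷ v ∷ L))
      ≡⟨ cong crossings (unfold-reverse u (v ∷ L)) ⟩
    crossings (reverse (v ∷ L) ∷ʳ u)
      ≡⟨ crossings-++ (reverse (v ∷ L)) [ u ] (last-reverse (v ∷ L) refl) refl ⟩
    crossings (reverse (v ∷ L)) + indicator (straddles? v u) + 0
      ≡⟨ +-identityʳ _ ⟩
    crossings (reverse (v ∷ L)) + indicator (straddles? v u)
      ≡⟨ cong₂ _+_ (crossings-reverse (v ∷ L)) (indicator-straddles-sym v u) ⟩
    crossings (v ∷ L) + indicator (straddles? u v)
      ≡⟨ +-comm (crossings (v ∷ L)) _ ⟩
    crossings (u ∷ v ∷ L) ∎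
    where open ≡-Reasoning

  crossings-framed : ∀ (K₁ Blk K₂ : List (Fin n)) {k₁ b₀ b₁ k₂} →
    last K₁ ≡ just k₁ → head Blk ≡ just b₀ → last Blk ≡ just b₁ → head K₂ ≡ just k₂ →
    (∀ {z} → z ∈ K₁ → ¬ D z) → (∀ {z} → z ∈ K₂ → ¬ D z) →
    crossings (K₁ ++ Blk ++ K₂) ≡ indicator (straddles? k₁ b₀) + crossings Blk + indicator (straddles? b₁ k₂)
  crossings-framed K₁ Blk K₂ {k₁} {b₀} {b₁} {k₂} ek₁ eb₀ eb₁ ek₂ out₁ out₂ = begin
    crossings (K₁ ++ Blk ++ K₂)
      ≡⟨ crossings-++ K₁ (Blk ++ K₂) ek₁ (head-++ K₂ eb₀) ⟩
    crossings K₁ + enter + crossings (Blk ++ K₂)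
      ≡⟨ cong₂ (λ c₁ c → c₁ + enter + c) (crossings-outside K₁ out₁) (crossings-++ Blk K₂ eb₁ ek₂) ⟩
    enter + (crossings Blk + leave + crossings K₂)
      ≡⟨ cong (λ c₂ → enter + (crossings Blk + leave + c₂)) (crossings-outside K₂ out₂) ⟩
    enter + (crossings Blk + leave + 0)
      ≡⟨ cong (enter +_) (+-identityʳ _) ⟩
    enter + (crossings Blk + leave)
      ≡⟨ sym (+-assoc enter _ leave) ⟩
    enter + crossings Blk + leave ∎
    where
    open ≡-Reasoning
    enter leave : ℕ
    enter = indicator (straddles? k₁ b₀)
    leave = indicator (straddles? b₁ k₂)

  crossings-framed-inside : ∀ (K₁ Blk K₂ : List (Fin n)) {k₁ b₀ b₁ k₂} →
    last K₁ ≡ just k₁ → head Blk ≡ just b₀ → last Blk ≡ just b₁ → head K₂ ≡ just k₂ →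
    (∀ {z} → z ∈ K₁ → ¬ D z) → (∀ {z} → z ∈ K₂ → ¬ D z) → (∀ {z} → z ∈ Blk → D z) →
    crossings (K₁ ++ Blk ++ K₂) ≡ 2
  crossings-framed-inside K₁ Blk K₂ ek₁ eb₀ eb₁ ek₂ out₁ out₂ inside =
    trans (crossings-framed K₁ Blk K₂ ek₁ eb₀ eb₁ ek₂ out₁ out₂)
      (cong₂ _+_ (cong₂ _+_ (indicator-yes (straddles? _ _) (inj₂ (out₁ (last⇒∈ ek₁) , inside (head⇒∈ eb₀))))
                            (crossings-inside Blk inside))
                 (indicator-yes (straddles? _ _) (inj₁ (inside (last⇒∈ eb₁) , out₂ (head⇒∈ ek₂)))))

  crossings-framed-outside : ∀ (K₁ Blk K₂ : List (Fin n)) {k₁ b₀ b₁ k₂} →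
    last K₁ ≡ just k₁ → head Blk ≡ just b₀ → last Blk ≡ just b₁ → head K₂ ≡ just k₂ →
    (∀ {z} → z ∈ K₁ → ¬ D z) → (∀ {z} → z ∈ K₂ → ¬ D z) → ¬ D b₀ → ¬ D b₁ →
    crossings (K₁ ++ Blk ++ K₂) ≡ crossings Blk
  crossings-framed-outside K₁ Blk K₂ ek₁ eb₀ eb₁ ek₂ out₁ out₂ ¬Db₀ ¬Db₁ =
    trans (crossings-framed K₁ Blk K₂ ek₁ eb₀ eb₁ ek₂ out₁ out₂)
      (trans (cong₂ (λ i₁ i₂ → i₁ + crossings Blk + i₂)
                    (indicator-no (straddles? _ _) λ { (inj₁ (Dk , _)) → out₁ (last⇒∈ ek₁) Dk
                                                     ; (inj₂ (_ , Db)) → ¬Db₀ Db })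
                    (indicator-no (straddles? _ _) λ { (inj₁ (Db , _)) → ¬Db₁ Db
                                                     ; (inj₂ (_ , Dk)) → out₂ (head⇒∈ ek₂) Dk }))
             (+-identityʳ _))

  first-crossing : ∀ {u v} → Dec (Straddles u v) → List (ℕ × ℕ)
  first-crossing (yes _) = (0 , 1) ∷ []
  first-crossing (no _)  = []

  shift : ℕ × ℕ → ℕ × ℕ
  shift (i , j) = suc i , suc j

  crossing-positions : List (Fin n) → List (ℕ × ℕ)
  crossing-positions []          = []
  crossing-positions (_ ∷ [])    = []
  crossing-positions (u ∷ v ∷ L) = first-crossing (straddles? u v) ++ map shift (crossing-positions (v ∷ L))

  shift-injective : ∀ {p q} → shift p ≡ shift q → p ≡ q
  shift-injective {_ , _} {_ , _} refl = refl

  first-crossing-unique : ∀ {u v} (d : Dec (Straddles u v)) {Y} → Unique Y → Unique (first-crossing d ++ map shift Y)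
  first-crossing-unique (yes _) uY =
    All.¬Any⇒All¬ _ (λ 01∈ → shift≢01 (proj₂ (proj₂ (∈-map⁻ shift 01∈)))) ∷ Unique.map⁺ shift-injective uY
    where
    shift≢01 : ∀ {p} → (0 , 1) ≢ shift p
    shift≢01 ()
  first-crossing-unique (no _)  uY = Unique.map⁺ shift-injective uY

  length-first-crossing : ∀ {u v} (d : Dec (Straddles u v)) Y →
                          length (first-crossing d ++ map shift Y) ≡ indicator d + length Y
  length-first-crossing (yes _) Y = cong suc (length-map shift Y)
  length-first-crossing (no _)  Y = length-map shift Y

  crossing-positions-unique : ∀ F → Unique (crossing-positions F)
  crossing-positions-unique []          = []
  crossing-positions-unique (_ ∷ [])    = []
  crossing-positions-unique (u ∷ v ∷ L) = first-crossing-unique (straddles? u v) (crossing-positions-unique (v ∷ L))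

  length-crossing-positions : ∀ F → length (crossing-positions F) ≡ crossings F
  length-crossing-positions []          = refl
  length-crossing-positions (_ ∷ [])    = refl
  length-crossing-positions (u ∷ v ∷ L) =
    trans (length-first-crossing (straddles? u v) _) (cong (_ +_) (length-crossing-positions (v ∷ L)))

  module _ {A B : Fin n → Set} (D⇒A : ∀ {z} → D z → A z) (¬D⇒B : ∀ {z} → ¬ D z → B z)
           (A∩B=∅ : ∀ {z} → A z → B z → ⊥) where

    A⇒D : ∀ {z} → A z → D z
    A⇒D {z} a with D? z
    ... | yes Dz = Dz
    ... | no ¬Dz = ⊥-elim (A∩B=∅ a (¬D⇒B ¬Dz))

    A∪B : ∀ z → A z ⊎ B z
    A∪B z with D? z
    ... | yes Dz = inj₁ (D⇒A Dz)
    ... | no ¬Dz = inj₂ (¬D⇒B ¬Dz)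

    CrossingAt : List (Fin n) → ℕ → ℕ → Set
    CrossingAt F i j = i < j × j < length F × (IsABPath A B (Segment F i j) ⊎ IsABPath B A (Segment F i j))

    straddles⇒ABPath : ∀ {u v} → Straddles u v → IsABPath A B (u ∷ v ∷ []) ⊎ IsABPath B A (u ∷ v ∷ [])
    straddles⇒ABPath (inj₁ (Du , ¬Dv)) = inj₁ (ABPath-pair⇐ A∩B=∅ (D⇒A Du) (¬D⇒B ¬Dv))
    straddles⇒ABPath (inj₂ (¬Du , Dv)) = inj₂ (ABPath-pair⇐ (λ b a → A∩B=∅ a b) (¬D⇒B ¬Du) (D⇒A Dv))

    ABPath⇒straddles : ∀ {u v} → IsABPath A B (u ∷ v ∷ []) ⊎ IsABPath B A (u ∷ v ∷ []) → Straddles u v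
    ABPath⇒straddles (inj₁ π) with ABPath-pair⇒ π
    ... | Au , Bv = inj₁ (A⇒D Au , λ Dv → A∩B=∅ (D⇒A Dv) Bv)
    ABPath⇒straddles (inj₂ π) with ABPath-pair⇒ π
    ... | Bu , Av = inj₂ ((λ Du → A∩B=∅ (D⇒A Du) Bu) , A⇒D Av)

    crossing-positions-sound : ∀ F {i j} → (i , j) ∈ crossing-positions F → CrossingAt F i j
    crossing-positions-sound (u ∷ v ∷ L) ij∈ =
      first-or-shifted (straddles? u v) (∈-++⁻ (first-crossing (straddles? u v)) ij∈)
      where
      first-or-shifted : ∀ {i j} (d : Dec (Straddles u v)) →
        (i , j) ∈ first-crossing d ⊎ (i , j) ∈ map shift (crossing-positions (v ∷ L)) → CrossingAt (u ∷ v ∷ L) i j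
      first-or-shifted (yes s) (inj₁ (here refl)) = s≤s z≤n , s≤s (s≤s z≤n) , straddles⇒ABPath s
      first-or-shifted (no _)  (inj₁ ())
      first-or-shifted _       (inj₂ ij∈shift) with ∈-map⁻ shift ij∈shift
      ... | (i , j) , ij∈ , refl with crossing-positions-sound (v ∷ L) ij∈
      ...   | i<j , j<∣L∣ , π = s≤s i<j , s≤s j<∣L∣ , π

    crossing-positions-complete : ∀ F → Unique F → ∀ i j → CrossingAt F i j → (i , j) ∈ crossing-positions F
    crossing-positions-complete (u ∷ v ∷ L) _ zero (suc zero) (_ , _ , π) =
      ∈-++⁺ˡ (first-crossing-∋ (straddles? u v) (ABPath⇒straddles π))
      where
      first-crossing-∋ : (d : Dec (Straddles u v)) → Straddles u v → (0 , 1) ∈ first-crossing d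
      first-crossing-∋ (yes _) _ = here refl
      first-crossing-∋ (no ¬s) s = ⊥-elim (¬s s)
    crossing-positions-complete (u ∷ v ∷ w ∷ L) uF zero (suc (suc j)) (_ , _ , inj₁ π) =
      ⊥-elim (¬ABPath-long A∪B (Unique.take⁺ (3 + j) uF) π)
    crossing-positions-complete (u ∷ v ∷ w ∷ L) uF zero (suc (suc j)) (_ , _ , inj₂ π) =
      ⊥-elim (¬ABPath-long (Data.Sum.swap ∘ A∪B) (Unique.take⁺ (3 + j) uF) π)
    crossing-positions-complete (u ∷ v ∷ L) (_ ∷ uF) (suc i) (suc j) (s≤s i<j , s≤s j<∣L∣ , π) =
      ∈-++⁺ʳ (first-crossing (straddles? u v))
             (∈-map⁺ shift (crossing-positions-complete (v ∷ L) uF i j (i<j , j<∣L∣ , π)))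
    crossing-positions-complete (_ ∷ []) _ zero zero (() , _)
    crossing-positions-complete (_ ∷ []) _ _ (suc j) (_ , s≤s () , _)
    crossing-positions-complete (_ ∷ _ ∷ _) _ zero zero (() , _)
    crossing-positions-complete (_ ∷ _ ∷ []) _ zero (suc (suc _)) (_ , s≤s (s≤s ()) , _)
    crossing-positions-complete (_ ∷ _ ∷ _) _ (suc _) zero (() , _)

    contains-crossings : ∀ F → Unique F → ContainsExactly A B F (crossings F)
    contains-crossings F uF = crossing-positions F , crossing-positions-unique F , length-crossing-positions F ,
      λ i j → mk⇔ (crossing-positions-sound F) (crossing-positions-complete F uF i j)

-- The bipartite cube of a tree

module BipartiteCube {n : ℕ} (T : Graph n) (tree : IsTree T) where
  open Paths (Adj T)
  open Acyclic (Graph.sym T) (proj₂ tree)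

  T³ : Rel n
  T³ = BipPower T 3

  path⇒Dist : ∀ {u v P k} → PathBetween (Adj T) u v P → length P ≡ suc k → Dist T u v k
  path⇒Dist π |P| = (_ , π , |P|) , λ Q π′ → ≤-reflexive (trans (sym |P|) (cong length (path-unique π π′)))

  Dist-sym : ∀ {u v k} → Dist T u v k → Dist T v u k
  Dist-sym ((P , π , |P|) , shortest) =
    (reverse P , PathBetween-reverse (Graph.sym T) π , trans (length-reverse P) |P|) ,
    λ Q π′ → subst (_ ≤_) (length-reverse Q) (shortest (reverse Q) (PathBetween-reverse (Graph.sym T) π′))

  T³-sym : ∀ {u v} → T³ u v → T³ v u
  T³-sym (k , d , odd , k≤3) = k , Dist-sym d , odd , k≤3

  Adj⇒T³ : ∀ {u v} → Adj T u v → T³ u v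
  Adj⇒T³ r = 1 , path⇒Dist (edge-path (λ { refl → Graph.irefl T r }) r) refl , (0 , refl) , s≤s z≤n

  path₃⇒T³ : ∀ {u a b v} → Adj T u a → Adj T a b → Adj T b v → Unique (u ∷ a ∷ b ∷ v ∷ []) → T³ u v
  path₃⇒T³ r₁ r₂ r₃ uq = 3 , path⇒Dist ((r₁ ∷ r₂ ∷ r₃ ∷ [-] , uq) , refl , refl) refl , (1 , refl) , ≤-refl

-- The Hamiltonian path

module HamiltonianTour {n : ℕ} (T : Graph n) (tree : IsTree T) (Mt : PerfectMatching T) (root : Fin n) where
  open RootedTree T tree root
  open BipartiteCube T tree
  module Cross (c : Fin n) = Crossings (c ≼?_)

  mate : Fin n → Fin n
  mate v = proj₁ (cover Mt v)

  mate-M : ∀ v → M Mt v (mate v)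
  mate-M v = proj₂ (cover Mt v)

  mate-Child : ∀ {p r} → Child p r → ¬ M Mt r p → Child r (mate r)
  mate-Child p→r ¬M with Adj⇒Child (inE Mt (mate-M _))
  ... | inj₁ r→m = r→m
  ... | inj₂ m→r with parent-unique m→r p→r
  ...   | refl = ⊥-elim (¬M (mate-M _))

  children : Fin n → List (Fin n)
  children v = filter (Child? v) (allFin n)

  ∈-children⇒Child : ∀ {v c} → c ∈ children v → Child v c
  ∈-children⇒Child {v} c∈ = proj₂ (∈-filter⁻ (Child? v) {xs = allFin n} c∈)

  Child⇒∈-children : ∀ {v c} → Child v c → c ∈ children v
  Child⇒∈-children {v} {c} v→c = ∈-filter⁺ (Child? v) (∈-allFin c) v→c

  children-unique : ∀ v → Unique (children v)
  children-unique v = Unique.filter⁺ (Child? v) (Unique.allFin⁺ n)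

  unmatchedChildren : Fin n → List (Fin n)
  unmatchedChildren a = filter (λ c → ¬? (c ≟ᶠ mate a)) (children a)

  ∈-unmatchedChildren⇒ : ∀ {a c} → c ∈ unmatchedChildren a → Child a c × c ≢ mate a
  ∈-unmatchedChildren⇒ {a} c∈ with ∈-filter⁻ (λ c → ¬? (c ≟ᶠ mate a)) {xs = children a} c∈
  ... | c∈children , c≢b = ∈-children⇒Child c∈children , c≢b

  ⇒∈-unmatchedChildren : ∀ {a c} → Child a c → c ≢ mate a → c ∈ unmatchedChildren a
  ⇒∈-unmatchedChildren {a} a→c c≢b = ∈-filter⁺ (λ c → ¬? (c ≟ᶠ mate a)) (Child⇒∈-children a→c) c≢b

  unmatchedChildren-unique : ∀ a → Unique (unmatchedChildren a)
  unmatchedChildren-unique a = Unique.filter⁺ (λ c → ¬? (c ≟ᶠ mate a)) (children-unique a)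

  distinct₄ : ∀ {u a b v : Fin n} → u ≢ a → u ≢ b → u ≢ v → a ≢ b → a ≢ v → b ≢ v → Unique (u ∷ a ∷ b ∷ v ∷ [])
  distinct₄ ua ub uv ab av bv = (ua ∷ ub ∷ uv ∷ []) ∷ (ab ∷ av ∷ []) ∷ (bv ∷ []) ∷ [] ∷ []

  grandchild-T³ : ∀ {a b d e} → Child a b → Child b d → Child d e → T³ a e
  grandchild-T³ a→b b→d d→e = path₃⇒T³ (Child⇒Adj a→b) (Child⇒Adj b→d) (Child⇒Adj d→e)
    (distinct₄ (Child⇒≢ a→b ≼-refl) (Child⇒≢ a→b (Child⇒≼ b→d)) (Child⇒≢ a→b (≼-trans (Child⇒≼ b→d) (Child⇒≼ d→e)))
               (Child⇒≢ b→d ≼-refl) (Child⇒≢ b→d (Child⇒≼ d→e)) (Child⇒≢ d→e ≼-refl))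

  cousin-T³ : ∀ {p u v w} → Child p u → Child p v → u ≢ v → Child v w → T³ u w
  cousin-T³ p→u p→v u≢v v→w = path₃⇒T³ (Graph.sym T (Child⇒Adj p→u)) (Child⇒Adj p→v) (Child⇒Adj v→w)
    (distinct₄ (λ u≡p → Child⇒≢ p→u ≼-refl (sym u≡p)) u≢v
               (λ { refl → u≢v (siblings-disjoint p→u p→v ≼-refl (Child⇒≼ v→w)) })
               (Child⇒≢ p→v ≼-refl) (Child⇒≢ p→v (Child⇒≼ v→w)) (Child⇒≢ v→w ≼-refl))

  record Tour (r s t : Fin n) (L : List (Fin n)) : Set where
    field
      path          : PathBetween T³ s t L
      ∈⇒≼           : ∀ {z} → z ∈ L → r ≼ z
      ≼⇒∈           : ∀ {z} → r ≼ z → z ∈ L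
      crosses-twice : ∀ {p c} → Child p c → ¬ M Mt p c → r ≼ c → c ≢ r → Cross.crossings c L ≡ 2

    linked : Linked T³ L
    linked = proj₁ (proj₁ path)

    distinct : Unique L
    distinct = proj₂ (proj₁ path)

    starts : head L ≡ just s
    starts = proj₁ (proj₂ path)

    ends : last L ≡ just t
    ends = proj₂ (proj₂ path)

    walk : Linked T³ L × head L ≡ just s × last L ≡ just t
    walk = linked , starts , ends

  Tour-reverse : ∀ {r s t L} → Tour r s t L → Tour r t s (reverse L)
  Tour-reverse {L = L} τ = record
    { path          = Paths.PathBetween-reverse T³ T³-sym (Tour.path τ)
    ; ∈⇒≼           = λ z∈ → Tour.∈⇒≼ τ (Any.reverse⁻ {xs = L} z∈)
    ; ≼⇒∈           = λ r≼z → Any.reverse⁺ (Tour.≼⇒∈ τ r≼z)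
    ; crosses-twice = λ p→c ¬M r≼c c≢r → trans (Cross.crossings-reverse _ L) (Tour.crosses-twice τ p→c ¬M r≼c c≢r)
    }

  -- Meaningful when a is matched to a child and the fuel k exceeds the height of the subtree of a.
  hamPath : ℕ → Fin n → List (Fin n)
  hamPath zero    a = []
  hamPath (suc k) a = a ∷ concatMap (reverse ∘ hamPath k) (children (mate a))
                        ++ concatMap (hamPath k) (unmatchedChildren a) ++ [ mate a ]

  Bounded : ℕ → Fin n → Set
  Bounded k a = ∀ z → a ≼ z → depth z < depth a + k

  Bounded-suc : ∀ {k a} → Bounded k a → Bounded (suc k) a
  Bounded-suc {k} {a} bd z a≼z = ≤-trans (bd z a≼z) (+-monoʳ-≤ (depth a) (n≤1+n k))

  Bounded-Child : ∀ {k a c} → Child a c → Bounded (suc k) a → Bounded k c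
  Bounded-Child {k} {a} {c} a→c bd z c≼z = subst (depth z <_) (begin
    depth a + suc k   ≡⟨ +-suc (depth a) k ⟩
    suc (depth a) + k ≡⟨ cong (_+ k) (sym (depth-Child a→c)) ⟩
    depth c + k       ∎) (bd z (≼-trans (Child⇒≼ a→c) c≼z))
    where open ≡-Reasoning

  module Step (k : ℕ) (IH : ∀ r → Child r (mate r) → Bounded k r → Tour r r (mate r) (hamPath k r))
              (a : Fin n) (a→b : Child a (mate a)) (bounded : Bounded (suc k) a) where

    b : Fin n
    b = mate a

    Bs As : List (Fin n)
    Bs = concatMap (reverse ∘ hamPath k) (children b)
    As = concatMap (hamPath k) (unmatchedChildren a)

    a→c : ∀ {c} → c ∈ unmatchedChildren a → Child a c
    a→c = proj₁ ∘ ∈-unmatchedChildren⇒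

    c≢b : ∀ {c} → c ∈ unmatchedChildren a → c ≢ b
    c≢b = proj₂ ∘ ∈-unmatchedChildren⇒

    b→d : ∀ {d} → d ∈ children b → Child b d
    b→d = ∈-children⇒Child

    mate-below-A : ∀ {c} → c ∈ unmatchedChildren a → Child c (mate c)
    mate-below-A c∈ = mate-Child (a→c c∈) λ M-ca → c≢b c∈ (sym (unique Mt (mate-M a) (msym Mt M-ca)))

    mate-below-B : ∀ {d} → d ∈ children b → Child d (mate d)
    mate-below-B d∈ = mate-Child (b→d d∈) λ M-db →
      Child⇒≢ a→b (Child⇒≼ (b→d d∈)) (unique Mt (msym Mt (mate-M a)) (msym Mt M-db))

    tourA : ∀ {c} → c ∈ unmatchedChildren a → Tour c c (mate c) (hamPath k c)
    tourA c∈ = IH _ (mate-below-A c∈) (Bounded-Child (a→c c∈) bounded)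

    tourB : ∀ {d} → d ∈ children b → Tour d (mate d) d (reverse (hamPath k d))
    tourB d∈ = Tour-reverse (IH _ (mate-below-B d∈) (Bounded-Child (b→d d∈) (Bounded-suc (Bounded-Child a→b bounded))))

    in-Bs : ∀ {z} → z ∈ Bs → ∃ λ d → Child b d × d ≼ z
    in-Bs z∈ with ∈-concatMap-find (reverse ∘ hamPath k) z∈
    ... | d , d∈ , z∈d = d , b→d d∈ , Tour.∈⇒≼ (tourB d∈) z∈d

    in-As : ∀ {z} → z ∈ As → ∃ λ c → (Child a c × c ≢ b) × c ≼ z
    in-As z∈ with ∈-concatMap-find (hamPath k) z∈
    ... | c , c∈ , z∈c = c , ∈-unmatchedChildren⇒ c∈ , Tour.∈⇒≼ (tourA c∈) z∈c

    below-child : ∀ {z} → z ∈ Bs ++ As ++ [ b ] → ∃ λ r → Child a r × r ≼ z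
    below-child z∈ with ∈-++⁻ Bs z∈
    ... | inj₁ z∈Bs = let d , b→d , d≼z = in-Bs z∈Bs in b , a→b , ≼-trans (Child⇒≼ b→d) d≼z
    ... | inj₂ z∈rest with ∈-++⁻ As z∈rest
    ...   | inj₁ z∈As = let c , (a→c , _) , c≼z = in-As z∈As in c , a→c , c≼z
    ...   | inj₂ (here refl) = b , a→b , ≼-refl

    BeforeAs : Fin n → Set
    BeforeAs p = (∀ {c} → c ∈ unmatchedChildren a → T³ p c) × T³ p b

    linked-As : ∀ {p} → BeforeAs p → Linked T³ (p ∷ As ++ [ b ])
    linked-As (p→As , p→b) =
      Linked-concatMap (hamPath k) id mate (unmatchedChildren-unique a) (Tour.walk ∘ tourA)
        (λ c∈ c′∈ c≢c′ → T³-sym (cousin-T³ (a→c c′∈) (a→c c∈) (λ e → c≢c′ (sym e)) (mate-below-A c∈)))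
        (λ c∈ → T³-sym (cousin-T³ a→b (a→c c∈) (λ b≡c → c≢b c∈ (sym b≡c)) (mate-below-A c∈)))
        (λ m→b → m→b ∷ [-]) p→As p→b

    linked : Linked T³ (hamPath (suc k) a)
    linked = Linked-concatMap (reverse ∘ hamPath k) mate id {Q = BeforeAs} (children-unique b) (Tour.walk ∘ tourB)
      (λ d∈ d′∈ d≢d′ → cousin-T³ (b→d d∈) (b→d d′∈) d≢d′ (mate-below-B d′∈))
      (λ d∈ → (λ c∈ → T³-sym (cousin-T³ (a→c c∈) a→b (c≢b c∈) (b→d d∈))) ,
              Adj⇒T³ (Graph.sym T (Child⇒Adj (b→d d∈))))
      linked-As
      (λ d∈ → grandchild-T³ a→b (b→d d∈) (mate-below-B d∈))
      ((λ c∈ → Adj⇒T³ (Child⇒Adj (a→c c∈))) , Adj⇒T³ (Child⇒Adj a→b))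

    unique-Bs : Unique Bs
    unique-Bs = Unique-concatMap (reverse ∘ hamPath k) (Tour.distinct ∘ tourB)
      (λ d∈ d′∈ z∈ z∈′ → siblings-disjoint (b→d d∈) (b→d d′∈) (Tour.∈⇒≼ (tourB d∈) z∈) (Tour.∈⇒≼ (tourB d′∈) z∈′))
      (children-unique b)

    unique-As : Unique As
    unique-As = Unique-concatMap (hamPath k) (Tour.distinct ∘ tourA)
      (λ c∈ c′∈ z∈ z∈′ → siblings-disjoint (a→c c∈) (a→c c′∈) (Tour.∈⇒≼ (tourA c∈) z∈) (Tour.∈⇒≼ (tourA c′∈) z∈′))
      (unmatchedChildren-unique a)

    unique-path : Unique (hamPath (suc k) a)
    unique-path = All.¬Any⇒All¬ _ a∉ ∷ ++⁺ unique-Bs (++⁺ unique-As ([] ∷ []) As∌b) Bs∩rest=∅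
      where
      a∉ : a ∉ Bs ++ As ++ [ b ]
      a∉ a∈ = let r , a→r , r≼a = below-child a∈ in Child⇒≢ a→r r≼a refl
      As∌b : ∀ {z} → ¬ (z ∈ As × z ∈ [ b ])
      As∌b (z∈ , here refl) = let c , (a→c , c≢b) , c≼b = in-As z∈ in c≢b (siblings-disjoint a→c a→b c≼b ≼-refl)
      Bs∩rest=∅ : ∀ {z} → ¬ (z ∈ Bs × z ∈ As ++ [ b ])
      Bs∩rest=∅ (z∈Bs , z∈rest) with in-Bs z∈Bs | ∈-++⁻ As z∈rest
      ... | d , b→d , d≼z | inj₁ z∈As = let c , (a→c , c≢b) , c≼z = in-As z∈As in
                                         c≢b (siblings-disjoint a→c a→b c≼z (≼-trans (Child⇒≼ b→d) d≼z))
      ... | d , b→d , d≼z | inj₂ (here refl) = Child⇒≢ b→d d≼z refl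

    covers : ∀ {z} → a ≼ z → z ∈ hamPath (suc k) a
    covers {z} a≼z with z ≟ᶠ a
    ... | yes refl = here refl
    ... | no z≢a with ≼-step a≼z z≢a
    ...   | e , a→e , e≼z with e ≟ᶠ b
    ...     | no e≢b = there (∈-++⁺ʳ Bs (∈-++⁺ˡ (∈-concatMap (hamPath k) e∈ (Tour.≼⇒∈ (tourA e∈) e≼z))))
      where
      e∈ : e ∈ unmatchedChildren a
      e∈ = ⇒∈-unmatchedChildren a→e e≢b
    ...     | yes refl with z ≟ᶠ b
    ...       | yes refl = there (∈-++⁺ʳ Bs (∈-++⁺ʳ As (here refl)))
    ...       | no z≢b with ≼-step e≼z z≢b
    ...         | d , b→d , d≼z = there (∈-++⁺ˡ (∈-concatMap (reverse ∘ hamPath k) d∈ (Tour.≼⇒∈ (tourB d∈) d≼z)))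
      where
      d∈ : d ∈ children b
      d∈ = Child⇒∈-children b→d

    crossings-through-block : ∀ {r s t p c} (K₁ L K₂ : List (Fin n)) →
      hamPath (suc k) a ≡ (a ∷ K₁) ++ L ++ (K₂ ∷ʳ b) → Child r (mate r) → Tour r s t L →
      (s ≡ r × t ≡ mate r) ⊎ (s ≡ mate r × t ≡ r) →
      Child p c → ¬ M Mt p c → r ≼ c → Cross.crossings c (hamPath (suc k) a) ≡ 2
    crossings-through-block {r} {s} {t} {p} {c} K₁ L K₂ eq r→m τ ends p→c ¬M r≼c =
      trans (cong (Cross.crossings c) eq) (through (c ≟ᶠ r))
      where
      uH : Unique ((a ∷ K₁) ++ L ++ (K₂ ∷ʳ b))
      uH = subst Unique eq unique-path
      -- The subtree of c lies inside the block L, so by uniqueness nothing outside L is below c.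
      out₁ : ∀ {z} → z ∈ a ∷ K₁ → ¬ c ≼ z
      out₁ z∈ c≼z = Unique-++⁻-disjoint (a ∷ K₁) uH z∈ (∈-++⁺ˡ (Tour.≼⇒∈ τ (≼-trans r≼c c≼z)))
      out₂ : ∀ {z} → z ∈ K₂ ∷ʳ b → ¬ c ≼ z
      out₂ z∈ c≼z = Unique-++⁻-disjoint L (Unique-++⁻ʳ (a ∷ K₁) uH) (Tour.≼⇒∈ τ (≼-trans r≼c c≼z)) z∈
      r-outside : c ≢ r → ¬ c ≼ r
      r-outside c≢r c≼r = c≢r (sym (≼-antisym r≼c c≼r))
      mate-outside : c ≢ r → ¬ c ≼ mate r
      mate-outside c≢r c≼m with between-Child r≼c r→m c≼m
      ... | inj₁ c≡r  = c≢r c≡r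
      ... | inj₂ refl = ¬M (subst (λ q → M Mt q c) (sym (parent-unique p→c r→m)) (mate-M r))
      ends-outside : c ≢ r → ¬ c ≼ s × ¬ c ≼ t
      ends-outside c≢r = Data.Sum.[
          (λ (s≡r , t≡m) → outside s≡r (r-outside c≢r) , outside t≡m (mate-outside c≢r)) ,
          (λ (s≡m , t≡r) → outside s≡m (mate-outside c≢r) , outside t≡r (r-outside c≢r)) ]′ ends
        where
        outside : ∀ {x y} → x ≡ y → ¬ c ≼ y → ¬ c ≼ x
        outside refl = id
      last-K₁ : ∃ λ k₁ → last (a ∷ K₁) ≡ just k₁
      last-K₁ = ∃-last a K₁
      head-K₂ : ∃ λ k₂ → head (K₂ ∷ʳ b) ≡ just k₂
      head-K₂ = ∃-head-∷ʳ K₂ b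
      through : Dec (c ≡ r) → Cross.crossings c ((a ∷ K₁) ++ L ++ (K₂ ∷ʳ b)) ≡ 2
      through (yes refl) = Cross.crossings-framed-inside c (a ∷ K₁) L (K₂ ∷ʳ b)
        (proj₂ last-K₁) (Tour.starts τ) (Tour.ends τ) (proj₂ head-K₂) out₁ out₂ (Tour.∈⇒≼ τ)
      through (no c≢r) = let s-out , t-out = ends-outside c≢r in
        trans (Cross.crossings-framed-outside c (a ∷ K₁) L (K₂ ∷ʳ b)
                 (proj₂ last-K₁) (Tour.starts τ) (Tour.ends τ) (proj₂ head-K₂) out₁ out₂ s-out t-out)
              (Tour.crosses-twice τ p→c ¬M r≼c c≢r)

    crosses-in-A : ∀ {p c e} → Child p c → ¬ M Mt p c → Child a e → e ≢ b → e ≼ c →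
                   Cross.crossings c (hamPath (suc k) a) ≡ 2
    crosses-in-A {e = e} p→c ¬M a→e e≢b e≼c with concatMap-split (hamPath k) (⇒∈-unmatchedChildren a→e e≢b)
    ... | pre , post , As≡ =
      crossings-through-block (Bs ++ pre) H post regroup (mate-below-A e∈) (tourA e∈) (inj₁ (refl , refl)) p→c ¬M e≼c
      where
      e∈ : e ∈ unmatchedChildren a
      e∈ = ⇒∈-unmatchedChildren a→e e≢b
      H : List (Fin n)
      H = hamPath k e
      regroup : hamPath (suc k) a ≡ (a ∷ Bs ++ pre) ++ H ++ (post ∷ʳ b)
      regroup = cong (a ∷_) (begin
        Bs ++ As ++ [ b ]                  ≡⟨ cong (λ X → Bs ++ X ++ [ b ]) As≡ ⟩
        Bs ++ (pre ++ H ++ post) ++ [ b ]  ≡⟨ cong (Bs ++_) (++-assoc pre (H ++ post) [ b ]) ⟩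
        Bs ++ pre ++ (H ++ post) ++ [ b ]  ≡⟨ cong (λ X → Bs ++ pre ++ X) (++-assoc H post [ b ]) ⟩
        Bs ++ pre ++ H ++ post ++ [ b ]    ≡⟨ sym (++-assoc Bs pre _) ⟩
        (Bs ++ pre) ++ H ++ post ++ [ b ]  ∎)
        where open ≡-Reasoning

    crosses-in-B : ∀ {p c d} → Child p c → ¬ M Mt p c → Child b d → d ≼ c →
                   Cross.crossings c (hamPath (suc k) a) ≡ 2
    crosses-in-B {d = d} p→c ¬M b→d d≼c with concatMap-split (reverse ∘ hamPath k) (Child⇒∈-children b→d)
    ... | pre , post , Bs≡ =
      crossings-through-block pre R (post ++ As) regroup (mate-below-B d∈) (tourB d∈) (inj₂ (refl , refl)) p→c ¬M d≼c
      where
      d∈ : d ∈ children b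
      d∈ = Child⇒∈-children b→d
      R : List (Fin n)
      R = reverse (hamPath k d)
      regroup : hamPath (suc k) a ≡ (a ∷ pre) ++ R ++ ((post ++ As) ∷ʳ b)
      regroup = cong (a ∷_) (begin
        Bs ++ As ++ [ b ]                  ≡⟨ cong (_++ As ++ [ b ]) Bs≡ ⟩
        (pre ++ R ++ post) ++ As ++ [ b ]  ≡⟨ ++-assoc pre (R ++ post) _ ⟩
        pre ++ (R ++ post) ++ As ++ [ b ]  ≡⟨ cong (pre ++_) (++-assoc R post _) ⟩
        pre ++ R ++ post ++ As ++ [ b ]    ≡⟨ cong (λ X → pre ++ R ++ X) (sym (++-assoc post As [ b ])) ⟩
        pre ++ R ++ (post ++ As) ++ [ b ]  ∎)
        where open ≡-Reasoning

    crosses-twice : ∀ {p c} → Child p c → ¬ M Mt p c → a ≼ c → c ≢ a → Cross.crossings c (hamPath (suc k) a) ≡ 2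
    crosses-twice {c = c} p→c ¬M a≼c c≢a with ≼-step a≼c c≢a
    ... | e , a→e , e≼c with e ≟ᶠ b | c ≟ᶠ b
    ...   | no e≢b   | _        = crosses-in-A p→c ¬M a→e e≢b e≼c
    ...   | yes refl | yes refl = ⊥-elim (¬M (subst (λ q → M Mt q b) (sym (parent-unique p→c a→b)) (mate-M a)))
    ...   | yes refl | no c≢b   = let d , b→d , d≼c = ≼-step e≼c c≢b in crosses-in-B p→c ¬M b→d d≼c

    tour : Tour a a b (hamPath (suc k) a)
    tour = record
      { path          = (linked , unique-path) , refl , last-++-∷ʳ (a ∷ Bs) As b
      ; ∈⇒≼           = λ { (here refl) → ≼-refl
                          ; (there z∈) → let r , a→r , r≼z = below-child z∈ in ≼-trans (Child⇒≼ a→r) r≼z }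
      ; ≼⇒∈           = covers
      ; crosses-twice = crosses-twice
      }

  hamPath-Tour : ∀ k a → Child a (mate a) → Bounded k a → Tour a a (mate a) (hamPath k a)
  hamPath-Tour zero    a _   bd = ⊥-elim (<-irrefl refl (subst (depth a <_) (+-identityʳ (depth a)) (bd a ≼-refl)))
  hamPath-Tour (suc k) a a→b bd = Step.tour k (hamPath-Tour k) a a→b bd

  height : ℕ
  height = max 0 (map depth (allFin n))

  root-Bounded : Bounded (suc height) root
  root-Bounded z _ = subst (λ d → depth z < d + suc height) (sym (cong length rootPath-root))
    (s≤s (≤-trans (All.lookup (xs≤max 0 (map depth (allFin n))) (∈-map⁺ depth (∈-allFin z))) (n≤1+n height)))

  root-Child : ∀ {v} → Adj T root v → Child root v
  root-Child r with Adj⇒Child r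
  ... | inj₁ root→v = root→v
  ... | inj₂ v→root = ⊥-elim (Child⇒≢ v→root (root-≼ _) refl)

  root-tour : Tour root root (mate root) (hamPath (suc height) root)
  root-tour = hamPath-Tour (suc height) root (root-Child (inE Mt (mate-M root))) root-Bounded

  crossings⇒CrossesExactly : ∀ {p c L} → Child p c → Unique L → CrossesExactly T c p L (Cross.crossings c L)
  crossings⇒CrossesExactly p→c uL = Cross.contains-crossings _ (≼⇒Side p→c) (⋠⇒Side p→c) (sides-disjoint p→c) _ uL

  root-tour-crosses : ∀ {p c} → Child p c → ¬ M Mt p c → CrossesExactly T c p (hamPath (suc height) root) 2
  root-tour-crosses p→c ¬M = subst (CrossesExactly T _ _ _) (Tour.crosses-twice root-tour p→c ¬M (root-≼ _) c≢root)
                                   (crossings⇒CrossesExactly p→c (Tour.distinct root-tour))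
    where
    c≢root : _ ≢ root
    c≢root refl = Child⇒≢ p→c (root-≼ _) refl

lemma2p1 : ∀ {n} (T : Graph n) → IsTree T → (Mt : PerfectMatching T)
    → ∀ x y → M Mt x y
    → ∃ λ P → PathBetween (BipPower T 3) x y P × (∀ v → v ∈ P)
        × (∀ u v → Adj T u v → ¬ M Mt u v → CrossesExactly T u v P 2)
lemma2p1 T tree Mt x y x-y = hamPath (suc height) x , x⇝y , (λ v → Tour.≼⇒∈ root-tour (root-≼ v)) , crosses
  where
  open RootedTree T tree x using (Adj⇒Child; root-≼)
  open HamiltonianTour T tree Mt x
  x⇝y : PathBetween (BipPower T 3) x y (hamPath (suc height) x)
  x⇝y = subst (λ t → PathBetween (BipPower T 3) x t (hamPath (suc height) x))
              (unique Mt (mate-M x) x-y) (Tour.path root-tour)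
  crosses : ∀ u v → Adj T u v → ¬ M Mt u v → CrossesExactly T u v (hamPath (suc height) x) 2
  crosses u v u-v ¬M with Adj⇒Child u-v
  ... | inj₁ u→v = ContainsExactly-swap (root-tour-crosses u→v ¬M)
  ... | inj₂ v→u = root-tour-crosses v→u (¬M ∘ msym Mt)
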